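{- Let $p$ be a prime, $q$ a power of $p$, $l$ a prime different from $p$, and let $\theta\colon \mathbb{F}_q\to\overline{\mathbb{Q}}_l^{\times}$ be a non-trivial additive character. Let $V\subset\mathbb{P}^3_{\mathbb{F}_q}=\operatorname{Proj}\mathbb{F}_q[x_1,x_2,x_3,x_4]$ be the closed subscheme (the image of the triple embedding $\mathbb{P}^1\hookrightarrow\mathbb{P}^3$) defined by the three homogeneous polynomials \[ f_1=x_1x_3-x_2^2,\quad f_2=x_2x_4-x_3^2,\quad f_3=x_1x_4-x_2x_3. \] Let \[ L=\sum_{t_1,t_2,t_3\in\mathbb{F}_q^{\times}}\theta\left(t_1+t_2+t_3-t_1^2t_2^{ -2}t_3-t_1^2t_2^{ -3}t_3^2-t_1t_2^{ -2}t_3^2\right). \] Then the number of $\mathbb{F}_q$-rational points of $V$ satisfies \[ \#V(\mathbb{F}_q)=-2q^2+6q-1+\frac{(q-1)L-1}{q}. \]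
   Context: $\overline{\mathbb{Q}}_l$ denotes an algebraic closure of the $l$-adic numbers. An additive character is a group homomorphism $(\mathbb{F}_q,+)\to\overline{\mathbb{Q}}_l^{\times}$; non-trivial means not identically $1$. -}

module Defs where

open import Level using (0ℓ)
open import Algebra.Bundles using (CommutativeRing)
open import Data.Nat as ℕ using (ℕ; zero; suc)
open import Data.Bool using (Bool; true; false; if_then_else_; _∧_)
open import Data.List using (List; []; _∷_; length; filter; map; concatMap; foldr)
open import Data.List.Relation.Unary.Any using (Any)
open import Data.List.Relation.Unary.AllPairs using (AllPairs)
open import Data.Vec using (Vec)
open import Data.Fin using (Fin; toℕ)
import Data.Vec as Vec
open import Data.Product using (_×_; _,_; ∃)
open import Relation.Nullary using (¬_; Dec; yes; no)
open import Relation.Nullary.Decidable using (⌊_⌋)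
open import Relation.Binary.PropositionalEquality using (_≡_)

record Field : Set₁ where
  field
    commRing : CommutativeRing 0ℓ 0ℓ
  open CommutativeRing commRing public
  field
    _⁻¹      : Carrier → Carrier
    ⁻¹-cong  : ∀ {x y} → x ≈ y → x ⁻¹ ≈ y ⁻¹
    0⁻¹      : 0# ⁻¹ ≈ 0#
    ⁻¹-inverseʳ : ∀ x → ¬ x ≈ 0# → x * (x ⁻¹) ≈ 1#
    0≉1      : ¬ 0# ≈ 1#

  ι : ℕ → Carrier
  ι zero    = 0#
  ι (suc n) = 1# + ι n

  _^ᶠ_ : Carrier → ℕ → Carrier
  x ^ᶠ zero  = 1#
  x ^ᶠ suc n = x * (x ^ᶠ n)

record FiniteField : Set₁ where
  field
    fld : Field
  open Field fld public
  field
    _≟_      : (x y : Carrier) → Dec (x ≈ y)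
    elems    : List Carrier
    complete : ∀ x → Any (x ≈_) elems
    distinct : AllPairs (λ a b → ¬ a ≈ b) elems

  card : ℕ
  card = length elems

  isZero : Carrier → Bool
  isZero x = ⌊ x ≟ 0# ⌋

  isOne : Carrier → Bool
  isOne x = ⌊ x ≟ 1# ⌋

  units : List Carrier
  units = filter (λ x → Relation.Nullary.¬? (x ≟ 0#)) elems

  -- Points of P^3(F_q) in normalized homogeneous coordinates:
  -- (x1:x2:x3:x4) with first nonzero coordinate equal to 1.
  normalized : Carrier → Carrier → Carrier → Carrier → Bool
  normalized x₁ x₂ x₃ x₄ =
    if isZero x₁ then
      (if isZero x₂ then
        (if isZero x₃ then
          (if isZero x₄ then false else isOne x₄)
         else isOne x₃)
       else isOne x₂)
    else isOne x₁

  quads : List (Carrier × Carrier × Carrier × Carrier)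
  quads = concatMap (λ a → concatMap (λ b → concatMap (λ c → map (λ d → (a , b , c , d)) elems) elems) elems) elems

  countProj : List (Carrier → Carrier → Carrier → Carrier → Carrier) → ℕ
  countProj fs = length (filter (λ { (a , b , c , d) →
      Data.Bool.T? (normalized a b c d ∧ foldr (λ f r → isZero (f a b c d) ∧ r) true fs) }) quads)

module TwistedCubic (F : FiniteField) where
  open FiniteField F
  f₁ f₂ f₃ : Carrier → Carrier → Carrier → Carrier → Carrier
  f₁ x₁ x₂ x₃ x₄ = x₁ * x₃ - x₂ * x₂
  f₂ x₁ x₂ x₃ x₄ = x₂ * x₄ - x₃ * x₃
  f₃ x₁ x₂ x₃ x₄ = x₁ * x₄ - x₂ * x₃

  #V : ℕ
  #V = countProj (f₁ ∷ f₂ ∷ f₃ ∷ [])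

CharZero : Field → Set
CharZero K = ∀ n → ¬ (ι (suc n) ≈ 0#)
  where open Field K

AlgClosed : Field → Set
AlgClosed K = ∀ n (a : Fin (suc n) → Carrier) →
  ∃ λ x → (x ^ᶠ suc n) + Vec.foldr′ _+_ 0# (Vec.tabulate (λ i → a i * (x ^ᶠ toℕ i))) ≈ 0#
  where open Field K

record NontrivialAdditiveCharacter (F : FiniteField) (K : Field)
       (θ : FiniteField.Carrier F → Field.Carrier K) : Set where
  private
    module F = FiniteField F
    module K = Field K
  field
    cong       : ∀ {x y} → x F.≈ y → θ x K.≈ θ y
    nonzero    : ∀ x → ¬ θ x K.≈ K.0#
    hom        : ∀ x y → θ (x F.+ y) K.≈ θ x K.* θ y
    nontrivial : ∃ λ x → ¬ θ x K.≈ K.1#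

module ExpSum (F : FiniteField) (K : Field) (θ : FiniteField.Carrier F → Field.Carrier K) where
  private
    module F = FiniteField F
    module K = Field K
  open F using (_+_; _-_; _*_; _⁻¹; units)

  phase : F.Carrier → F.Carrier → F.Carrier → F.Carrier
  phase t₁ t₂ t₃ =
    t₁ + t₂ + t₃
      - (t₁ * t₁) * (t₂ ⁻¹ * t₂ ⁻¹) * t₃
      - (t₁ * t₁) * (t₂ ⁻¹ * t₂ ⁻¹ * t₂ ⁻¹) * (t₃ * t₃)
      - t₁ * (t₂ ⁻¹ * t₂ ⁻¹) * (t₃ * t₃)

  L : K.Carrier
  L = foldr K._+_ K.0#
        (concatMap (λ t₁ → concatMap (λ t₂ → map (λ t₃ → θ (phase t₁ t₂ t₃)) units) units) units)

module Submission where

-- The number of F_q-points of the twisted cubic V ⊂ P³ is q + 1, and the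
-- exponential sum L can be evaluated in closed form, L = 2q² - 3q - 1; the
-- theorem is the identity q + 1 = -2q² + 6q - 1 + ((q - 1)L - 1)/q in K.

open import Defs
open import Level using (Level)
open import Algebra.Bundles using (CommutativeRing; CommutativeSemiring)
open import Data.Nat as ℕ using (ℕ; zero; suc; _^_; _∸_; _≥_)
import Data.Nat.Properties as ℕₚ
open import Data.Nat.Primality using (Prime)
open import Data.Integer as ℤ using (ℤ; +_; -[1+_]; sign; ∣_∣; _◃_)
import Data.Integer.Properties as ℤₚ
open import Data.Sign as Sign using (Sign)
open import Data.Bool using (Bool; true; false; T; T?; if_then_else_; _∧_)
open import Data.Bool.Properties using (T-∧)
open import Data.List using (List; []; _∷_; length; filter; map; concatMap; foldr; _++_)
open import Data.List.Relation.Unary.Any using (Any; here; there)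
open import Data.List.Relation.Unary.All using (All; []; _∷_)
open import Data.List.Relation.Unary.AllPairs using (AllPairs; _∷_)
open import Data.Maybe using (Maybe; just; nothing)
open import Data.Product using (_×_; _,_; proj₁; proj₂)
open import Data.Sum using (_⊎_; inj₁; inj₂; [_,_]; swap)
open import Data.Empty using (⊥-elim)
open import Function.Bundles using (Equivalence)
open import Relation.Nullary using (¬_; ¬?; Dec; yes; no; does; _×-dec_)
open import Relation.Binary.PropositionalEquality as ≡ using (_≡_; _≢_)

-- A solver for commutative-ring identities with integer constants.  The
-- ring homomorphism ℤ → R (n ↦ 1# + … + 1#) lets the library's
-- Algebra.Solver.Ring normalise both sides of an identity.
module IntegerRingSolver {c ℓ : Level} (R : CommutativeRing c ℓ) where
  open CommutativeRing R
  open import Algebra.Properties.Ring ring using (-‿distribˡ-*; -‿distribʳ-*; -0#≈0#; -‿involutive)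
  open import Algebra.Properties.AbelianGroup +-abelianGroup using (⁻¹-∙-comm)
  open import Algebra.Properties.CommutativeSemigroup +-commutativeSemigroup using (interchange)
  -- the type-checking optimised multiples, for which 1 · 1# is 1#
  open import Algebra.Properties.Semiring.Mult.TCOptimised semiring using (1+×; ×-homo-+; ×1-homo-*)
    renaming (_×_ to _·_)
  open import Algebra.Solver.Ring.AlmostCommutativeRing
    using (AlmostCommutativeRing; fromCommutativeRing; _-Raw-AlmostCommutative⟶_)
  open import Relation.Binary.Reasoning.Setoid setoid

  ⟦_⟧ : ℤ → Carrier
  ⟦ + n ⟧      = n · 1#
  ⟦ -[1+ n ] ⟧ = - (suc n · 1#)

  private
    -cancel-shift : ∀ a b → (1# + a) - (1# + b) ≈ a - b
    -cancel-shift a b = begin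
      (1# + a) - (1# + b)      ≈⟨ +-congˡ (⁻¹-∙-comm 1# b) ⟨
      (1# + a) + (- 1# + - b)  ≈⟨ interchange 1# a (- 1#) (- b) ⟩
      (1# - 1#) + (a - b)      ≈⟨ +-congʳ (-‿inverseʳ 1#) ⟩
      0# + (a - b)             ≈⟨ +-identityˡ _ ⟩
      a - b                    ∎

    x-0≈x : ∀ x → x - 0# ≈ x
    x-0≈x x = trans (+-congˡ -0#≈0#) (+-identityʳ x)

    ⊖-homo : ∀ m n → ⟦ m ℤ.⊖ n ⟧ ≈ m · 1# - n · 1#
    ⊖-homo zero    zero    = sym (x-0≈x 0#)
    ⊖-homo zero    (suc n) = sym (+-identityˡ _)
    ⊖-homo (suc m) zero    = sym (x-0≈x _)
    ⊖-homo (suc m) (suc n) rewrite ℤₚ.[1+m]⊖[1+n]≡m⊖n m n = begin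
      ⟦ m ℤ.⊖ n ⟧                    ≈⟨ ⊖-homo m n ⟩
      m · 1# - n · 1#                ≈⟨ -cancel-shift (m · 1#) (n · 1#) ⟨
      (1# + m · 1#) - (1# + n · 1#)  ≈⟨ +-cong (1+× m 1#) (-‿cong (1+× n 1#)) ⟨
      suc m · 1# - suc n · 1#        ∎

    +-homo : ∀ i j → ⟦ i ℤ.+ j ⟧ ≈ ⟦ i ⟧ + ⟦ j ⟧
    +-homo (+ m)    (+ n)    = ×-homo-+ 1# m n
    +-homo (+ m)    -[1+ n ] = ⊖-homo m (suc n)
    +-homo -[1+ m ] (+ n)    = trans (⊖-homo n (suc m)) (+-comm _ _)
    +-homo -[1+ m ] -[1+ n ] = begin
      - (suc (suc (m ℕ.+ n)) · 1#)     ≡⟨ ≡.cong (λ k → - (k · 1#)) (≡.sym (ℕₚ.+-suc (suc m) n)) ⟩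
      - ((suc m ℕ.+ suc n) · 1#)       ≈⟨ -‿cong (×-homo-+ 1# (suc m) (suc n)) ⟩
      - (suc m · 1# + suc n · 1#)      ≈⟨ ⁻¹-∙-comm _ _ ⟨
      - (suc m · 1#) + - (suc n · 1#)  ∎

    -‿homo : ∀ i → ⟦ ℤ.- i ⟧ ≈ - ⟦ i ⟧
    -‿homo (+ zero)  = sym -0#≈0#
    -‿homo (+ suc n) = refl
    -‿homo -[1+ n ]  = sym (-‿involutive _)

    -- multiplication goes through the sign/absolute-value decomposition
    signed : Sign → Carrier → Carrier
    signed Sign.+ x = x
    signed Sign.- x = - x

    signed-cong : ∀ s {x y} → x ≈ y → signed s x ≈ signed s y
    signed-cong Sign.+ e = e
    signed-cong Sign.- e = -‿cong e

    ◃-homo : ∀ s n → ⟦ s ◃ n ⟧ ≈ signed s (n · 1#)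
    ◃-homo Sign.+ zero    = refl
    ◃-homo Sign.- zero    = sym -0#≈0#
    ◃-homo Sign.+ (suc n) = refl
    ◃-homo Sign.- (suc n) = refl

    signed-* : ∀ s t x y → signed (s Sign.* t) (x * y) ≈ signed s x * signed t y
    signed-* Sign.+ Sign.+ x y = refl
    signed-* Sign.+ Sign.- x y = -‿distribʳ-* x y
    signed-* Sign.- Sign.+ x y = -‿distribˡ-* x y
    signed-* Sign.- Sign.- x y = begin
      x * y         ≈⟨ -‿involutive _ ⟨
      - - (x * y)   ≈⟨ -‿cong (-‿distribˡ-* x y) ⟩
      - (- x * y)   ≈⟨ -‿distribʳ-* _ _ ⟩
      - x * - y     ∎

    sign-abs : ∀ i → ⟦ i ⟧ ≈ signed (sign i) (∣ i ∣ · 1#)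
    sign-abs (+ n)    = refl
    sign-abs -[1+ n ] = refl

    *-homo : ∀ i j → ⟦ i ℤ.* j ⟧ ≈ ⟦ i ⟧ * ⟦ j ⟧
    *-homo i j = begin
      ⟦ i ℤ.* j ⟧                          ≈⟨ ◃-homo s (∣ i ∣ ℕ.* ∣ j ∣) ⟩
      signed s ((∣ i ∣ ℕ.* ∣ j ∣) · 1#)      ≈⟨ signed-cong s (×1-homo-* ∣ i ∣ ∣ j ∣) ⟩
      signed s (∣ i ∣ · 1# * ∣ j ∣ · 1#)     ≈⟨ signed-* (sign i) (sign j) _ _ ⟩
      signed (sign i) (∣ i ∣ · 1#) * signed (sign j) (∣ j ∣ · 1#) ≈⟨ *-cong (sign-abs i) (sign-abs j) ⟨
      ⟦ i ⟧ * ⟦ j ⟧                        ∎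
      where s = sign i Sign.* sign j

    almostRing : AlmostCommutativeRing c ℓ
    almostRing = fromCommutativeRing R

    morphism : ℤ.+-*-rawRing -Raw-AlmostCommutative⟶ almostRing
    morphism = record
      { ⟦_⟧ = ⟦_⟧ ; +-homo = +-homo ; *-homo = *-homo ; -‿homo = -‿homo
      ; 0-homo = refl ; 1-homo = refl }

    coeff≟ : ∀ i j → Maybe (⟦ i ⟧ ≈ ⟦ j ⟧)
    coeff≟ i j with i ℤ.≟ j
    ... | yes ≡.refl = just refl
    ... | no _       = nothing

  open import Algebra.Solver.Ring ℤ.+-*-rawRing almostRing morphism coeff≟ public
    using (Polynomial; solve; _:=_; _:+_; _:*_; _:-_; :-_; con)

  #_ : ∀ {m} → ℕ → Polynomial m
  # n = con (+ n)

module FieldFacts (K : Field) where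
  open Field K
  open import Algebra.Properties.Group +-group public using (x∙y⁻¹≈ε⇒x≈y; x≈y⇒x∙y⁻¹≈ε)
  open import Algebra.Properties.Semiring.Mult semiring renaming (_×_ to _·_)
  open import Relation.Binary.Reasoning.Setoid setoid

  ⁻¹-inverseˡ : ∀ x → ¬ x ≈ 0# → x ⁻¹ * x ≈ 1#
  ⁻¹-inverseˡ x x≉0 = trans (*-comm _ _) (⁻¹-inverseʳ x x≉0)

  *-cancel-zero : ∀ {u v} → u * v ≈ 0# → ¬ u ≈ 0# → v ≈ 0#
  *-cancel-zero {u} {v} uv≈0 u≉0 = begin
    v               ≈⟨ sym (*-identityˡ v) ⟩
    1# * v          ≈⟨ *-congʳ (sym (⁻¹-inverseˡ u u≉0)) ⟩
    (u ⁻¹ * u) * v  ≈⟨ *-assoc _ _ _ ⟩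
    u ⁻¹ * (u * v)  ≈⟨ *-congˡ uv≈0 ⟩
    u ⁻¹ * 0#       ≈⟨ zeroʳ _ ⟩
    0#              ∎

  inverse-unique : ∀ {a b} → ¬ a ≈ 0# → a * b ≈ 1# → b ≈ a ⁻¹
  inverse-unique {a} {b} a≉0 ab≈1 = begin
    b               ≈⟨ sym (*-identityˡ b) ⟩
    1# * b          ≈⟨ *-congʳ (sym (⁻¹-inverseˡ a a≉0)) ⟩
    (a ⁻¹ * a) * b  ≈⟨ *-assoc _ _ _ ⟩
    a ⁻¹ * (a * b)  ≈⟨ *-congˡ ab≈1 ⟩
    a ⁻¹ * 1#       ≈⟨ *-identityʳ _ ⟩
    a ⁻¹            ∎

  ⁻¹-nonzero : ∀ {u} → ¬ u ≈ 0# → ¬ u ⁻¹ ≈ 0#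
  ⁻¹-nonzero {u} u≉0 u⁻¹≈0 =
    0≉1 (trans (sym (trans (*-congˡ u⁻¹≈0) (zeroʳ u))) (⁻¹-inverseʳ u u≉0))

  *-zeroˡ : ∀ {a} x → a ≈ 0# → a * x ≈ 0#
  *-zeroˡ x a≈0 = trans (*-congʳ a≈0) (zeroˡ x)

  *-zeroʳ : ∀ {a} x → a ≈ 0# → x * a ≈ 0#
  *-zeroʳ x a≈0 = trans (*-congˡ a≈0) (zeroʳ x)

  idempotent⇒1 : ∀ {u} → ¬ u ≈ 0# → u ≈ u * u → u ≈ 1#
  idempotent⇒1 {u} u≉0 u≈u² = x∙y⁻¹≈ε⇒x≈y u 1# (*-cancel-zero (begin
    u * (u - 1#)         ≈⟨ distribˡ _ _ _ ⟩
    u * u + u * - 1#     ≈⟨ +-congˡ (sym (-‿distribʳ-* _ _)) ⟩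
    u * u - u * 1#       ≈⟨ +-cong (sym u≈u²) (-‿cong (*-identityʳ u)) ⟩
    u - u                ≈⟨ -‿inverseʳ u ⟩
    0#                   ∎) u≉0)
    where open import Algebra.Properties.Ring ring using (-‿distribʳ-*)

  ι≈×1 : ∀ n → ι n ≈ n · 1#
  ι≈×1 zero    = refl
  ι≈×1 (suc n) = +-congˡ (ι≈×1 n)

module ListSums {c ℓ : Level} (R : CommutativeSemiring c ℓ) where
  open CommutativeSemiring R
  open import Algebra.Properties.CommutativeSemigroup +-commutativeSemigroup using (interchange)
  open import Algebra.Properties.Semiring.Mult semiring renaming (_×_ to _·_)
  open import Relation.Binary.Reasoning.Setoid setoid

  ∑ : {a : Level} {A : Set a} → List A → (A → Carrier) → Carrier
  ∑ []       f = 0#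
  ∑ (x ∷ xs) f = f x + ∑ xs f

  𝟙 : {p : Level} {P : Set p} → Dec P → Carrier
  𝟙 P? = if does P? then 1# else 0#

  𝟙-yes : {p : Level} {P : Set p} (P? : Dec P) → P → 𝟙 P? ≈ 1#
  𝟙-yes (yes _) _  = refl
  𝟙-yes (no ¬p) p  = ⊥-elim (¬p p)

  𝟙-no : {p : Level} {P : Set p} (P? : Dec P) → ¬ P → 𝟙 P? ≈ 0#
  𝟙-no (yes p) ¬p = ⊥-elim (¬p p)
  𝟙-no (no _)  _  = refl

  𝟙-⊎ : {p q r : Level} {P : Set p} {Q : Set q} {S : Set r} (P? : Dec P) (Q? : Dec Q) (S? : Dec S) →
    (P → Q ⊎ S) → (Q ⊎ S → P) → ¬ (Q × S) → 𝟙 P? ≈ 𝟙 Q? + 𝟙 S?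
  𝟙-⊎ P? (yes q) (yes s) _    _     excl = ⊥-elim (excl (q , s))
  𝟙-⊎ P? (yes q) (no _)  _    from  _    = trans (𝟙-yes P? (from (inj₁ q))) (sym (+-identityʳ 1#))
  𝟙-⊎ P? (no _)  (yes s) _    from  _    = trans (𝟙-yes P? (from (inj₂ s))) (sym (+-identityˡ 1#))
  𝟙-⊎ P? (no ¬q) (no ¬s) to   _     _    = trans (𝟙-no P? λ p → [ ¬q , ¬s ] (to p)) (sym (+-identityˡ 0#))

  module _ {a : Level} {A : Set a} where
    ∑-cong : (xs : List A) {f g : A → Carrier} → (∀ x → f x ≈ g x) → ∑ xs f ≈ ∑ xs g
    ∑-cong []       f≈g = refl
    ∑-cong (x ∷ xs) f≈g = +-cong (f≈g x) (∑-cong xs f≈g)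

    ∑-zero : (xs : List A) {f : A → Carrier} → (∀ x → f x ≈ 0#) → ∑ xs f ≈ 0#
    ∑-zero []       f≈0 = refl
    ∑-zero (x ∷ xs) f≈0 = trans (+-cong (f≈0 x) (∑-zero xs f≈0)) (+-identityˡ 0#)

    ∑-+ : (xs : List A) (f g : A → Carrier) → ∑ xs (λ x → f x + g x) ≈ ∑ xs f + ∑ xs g
    ∑-+ []       f g = sym (+-identityˡ 0#)
    ∑-+ (x ∷ xs) f g = trans (+-congˡ (∑-+ xs f g)) (interchange (f x) (g x) (∑ xs f) (∑ xs g))

    ∑-*ˡ : (xs : List A) (a : Carrier) (f : A → Carrier) → ∑ xs (λ x → a * f x) ≈ a * ∑ xs f
    ∑-*ˡ []       a f = sym (zeroʳ a)
    ∑-*ˡ (x ∷ xs) a f = trans (+-congˡ (∑-*ˡ xs a f)) (sym (distribˡ _ _ _))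

    ∑-const : (xs : List A) (a : Carrier) → ∑ xs (λ _ → a) ≈ length xs · a
    ∑-const []       a = refl
    ∑-const (x ∷ xs) a = +-congˡ (∑-const xs a)

    ∑-++ : (xs ys : List A) (f : A → Carrier) → ∑ (xs ++ ys) f ≈ ∑ xs f + ∑ ys f
    ∑-++ []       ys f = sym (+-identityˡ _)
    ∑-++ (x ∷ xs) ys f = trans (+-congˡ (∑-++ xs ys f)) (sym (+-assoc _ _ _))

    ∑-filter : {p : Level} {P : A → Set p} (P? : ∀ x → Dec (P x)) (xs : List A) (f : A → Carrier) →
      ∑ (filter P? xs) f ≈ ∑ xs (λ x → if does (P? x) then f x else 0#)
    ∑-filter P? []       f = refl
    ∑-filter P? (x ∷ xs) f with does (P? x)
    ... | true  = +-congˡ (∑-filter P? xs f)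
    ... | false = trans (∑-filter P? xs f) (sym (+-identityˡ _))

    length-filter : {p : Level} {P : A → Set p} (P? : ∀ x → Dec (P x)) (xs : List A) →
      length (filter P? xs) · 1# ≈ ∑ xs (λ x → 𝟙 (P? x))
    length-filter P? xs = trans (sym (∑-const (filter P? xs) 1#)) (∑-filter P? xs (λ _ → 1#))

  module _ {a b : Level} {A : Set a} {B : Set b} where
    ∑-swap : (xs : List A) (ys : List B) (f : A → B → Carrier) →
      ∑ xs (λ x → ∑ ys (f x)) ≈ ∑ ys (λ y → ∑ xs (λ x → f x y))
    ∑-swap []       ys f = sym (∑-zero ys (λ _ → refl))
    ∑-swap (x ∷ xs) ys f = begin
      ∑ ys (f x) + ∑ xs (λ x → ∑ ys (f x))         ≈⟨ +-congˡ (∑-swap xs ys f) ⟩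
      ∑ ys (f x) + ∑ ys (λ y → ∑ xs (λ x → f x y)) ≈⟨ sym (∑-+ ys _ _) ⟩
      ∑ ys (λ y → f x y + ∑ xs (λ x → f x y))      ∎

    ∑-concatMap : (xs : List A) (g : A → List B) (f : B → Carrier) →
      ∑ (concatMap g xs) f ≈ ∑ xs (λ x → ∑ (g x) f)
    ∑-concatMap []       g f = refl
    ∑-concatMap (x ∷ xs) g f = trans (∑-++ (g x) (concatMap g xs) f) (+-congˡ (∑-concatMap xs g f))

    ∑-map : (xs : List A) (g : A → B) (f : B → Carrier) → ∑ (map g xs) f ≡ ∑ xs (λ x → f (g x))
    ∑-map []       g f = ≡.refl
    ∑-map (x ∷ xs) g f = ≡.cong (λ s → f (g x) + s) (∑-map xs g f)

  foldr-+ : (xs : List Carrier) → foldr _+_ 0# xs ≡ ∑ xs (λ x → x)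
  foldr-+ []       = ≡.refl
  foldr-+ (x ∷ xs) = ≡.cong (λ s → x + s) (foldr-+ xs)

module FiniteFieldSums (F : FiniteField) {c ℓ : Level} (R : CommutativeSemiring c ℓ) where
  private
    module F  = FiniteField F
    module FF = FieldFacts F.fld
  open CommutativeSemiring R
  open ListSums R
  open import Relation.Binary.Reasoning.Setoid setoid

  Σᶠ : (F.Carrier → Carrier) → Carrier
  Σᶠ = ∑ F.elems

  Σ* : (F.Carrier → Carrier) → Carrier
  Σ* = ∑ F.units

  Respectful : (F.Carrier → Carrier) → Set _
  Respectful f = ∀ {x y} → x F.≈ y → f x ≈ f y

  offZero : (F.Carrier → Carrier) → F.Carrier → Carrier
  offZero f x = if does (x F.≟ F.0#) then 0# else f x

  module _ {f : F.Carrier → Carrier} {y : F.Carrier} {v : Carrier}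
           (off-y : ∀ x → ¬ x F.≈ y → f x ≈ 0#) (at-y : ∀ x → x F.≈ y → f x ≈ v) where
    private
      ∑-avoiding : ∀ xs → All (λ x → ¬ x F.≈ y) xs → ∑ xs f ≈ 0#
      ∑-avoiding []       []         = refl
      ∑-avoiding (x ∷ xs) (x≉y ∷ ps) = trans (+-cong (off-y x x≉y) (∑-avoiding xs ps)) (+-identityˡ 0#)

      distinct-from : ∀ {x} xs → All (λ z → ¬ x F.≈ z) xs → Any (y F.≈_) xs → ¬ x F.≈ y
      distinct-from (z ∷ zs) (x≉z ∷ _)  (here y≈z) x≈y = x≉z (F.trans x≈y y≈z)
      distinct-from (z ∷ zs) (_ ∷ x≉zs) (there y∈zs)   = distinct-from zs x≉zs y∈zs

      rest-avoids : ∀ {x} xs → x F.≈ y → All (λ z → ¬ x F.≈ z) xs → All (λ z → ¬ z F.≈ y) xs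
      rest-avoids []       x≈y []          = []
      rest-avoids (z ∷ zs) x≈y (x≉z ∷ x≉zs) =
        (λ z≈y → x≉z (F.trans x≈y (F.sym z≈y))) ∷ rest-avoids zs x≈y x≉zs

      ∑-once : ∀ xs → AllPairs (λ a b → ¬ a F.≈ b) xs → Any (y F.≈_) xs → ∑ xs f ≈ v
      ∑-once (x ∷ xs) (x≉xs ∷ _) (here y≈x) = trans
        (+-cong (at-y x (F.sym y≈x)) (∑-avoiding xs (rest-avoids xs (F.sym y≈x) x≉xs)))
        (+-identityʳ v)
      ∑-once (x ∷ xs) (x≉xs ∷ distinct) (there y∈xs) = trans
        (+-cong (off-y x (distinct-from xs x≉xs y∈xs)) (∑-once xs distinct y∈xs))
        (+-identityˡ v)

    Σᶠ-point : Σᶠ f ≈ v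
    Σᶠ-point = ∑-once F.elems F.distinct (F.complete y)

  -- Sums over F are invariant under a bijection h (with inverse h⁻).
  -- Proof: both sides equal the sum of f over the graph of h.
  module _ (h h⁻ : F.Carrier → F.Carrier)
           (h-cong : ∀ {x y} → x F.≈ y → h x F.≈ h y) (h⁻-cong : ∀ {x y} → x F.≈ y → h⁻ x F.≈ h⁻ y)
           (h∘h⁻ : ∀ y → h (h⁻ y) F.≈ y) (h⁻∘h : ∀ x → h⁻ (h x) F.≈ x)
           {f : F.Carrier → Carrier} (f-resp : Respectful f) where
    private
      graph : F.Carrier → F.Carrier → Carrier
      graph x y = if does (y F.≟ h x) then f y else 0#

      row : ∀ x → Σᶠ (graph x) ≈ f (h x)
      row x = Σᶠ-point off on
        where
        off : ∀ y → ¬ y F.≈ h x → graph x y ≈ 0#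
        off y y≉hx with y F.≟ h x
        ... | yes y≈hx = ⊥-elim (y≉hx y≈hx)
        ... | no  _    = refl
        on : ∀ y → y F.≈ h x → graph x y ≈ f (h x)
        on y y≈hx with y F.≟ h x
        ... | yes _     = f-resp y≈hx
        ... | no  y≉hx  = ⊥-elim (y≉hx y≈hx)

      column : ∀ y → Σᶠ (λ x → graph x y) ≈ f y
      column y = Σᶠ-point off on
        where
        off : ∀ x → ¬ x F.≈ h⁻ y → graph x y ≈ 0#
        off x x≉h⁻y with y F.≟ h x
        ... | yes y≈hx = ⊥-elim (x≉h⁻y (F.trans (F.sym (h⁻∘h x)) (h⁻-cong (F.sym y≈hx))))
        ... | no  _    = refl
        on : ∀ x → x F.≈ h⁻ y → graph x y ≈ f y
        on x x≈h⁻y with y F.≟ h x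
        ... | yes _    = refl
        ... | no  y≉hx = ⊥-elim (y≉hx (F.sym (F.trans (h-cong x≈h⁻y) (h∘h⁻ y))))

    Σᶠ-reindex : Σᶠ (λ x → f (h x)) ≈ Σᶠ f
    Σᶠ-reindex = begin
      Σᶠ (λ x → f (h x))           ≈⟨ sym (∑-cong F.elems row) ⟩
      Σᶠ (λ x → Σᶠ (graph x))      ≈⟨ ∑-swap F.elems F.elems graph ⟩
      Σᶠ (λ y → Σᶠ (λ x → graph x y)) ≈⟨ ∑-cong F.elems column ⟩
      Σᶠ f                         ∎

  Σ*-as-Σᶠ : ∀ f → Σ* f ≈ Σᶠ (offZero f)
  Σ*-as-Σᶠ f = trans (∑-filter (λ x → ¬? (x F.≟ F.0#)) F.elems f) (∑-cong F.elems same)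
    where
    same : ∀ x → (if does (¬? (x F.≟ F.0#)) then f x else 0#) ≈ offZero f x
    same x with x F.≟ F.0#
    ... | yes _ = refl
    ... | no  _ = refl

  Σᶠ-split : ∀ {f} → Respectful f → Σᶠ f ≈ Σ* f + f F.0#
  Σᶠ-split {f} f-resp = begin
    Σᶠ f                                 ≈⟨ ∑-cong F.elems split ⟩
    Σᶠ (λ x → offZero f x + atZero x)    ≈⟨ ∑-+ F.elems _ _ ⟩
    Σᶠ (offZero f) + Σᶠ atZero           ≈⟨ +-cong (sym (Σ*-as-Σᶠ f)) (Σᶠ-point off on) ⟩
    Σ* f + f F.0#                        ∎
    where
    atZero : F.Carrier → Carrier
    atZero x = if does (x F.≟ F.0#) then f x else 0#
    split : ∀ x → f x ≈ offZero f x + atZero x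
    split x with x F.≟ F.0#
    ... | yes _ = sym (+-identityˡ _)
    ... | no  _ = sym (+-identityʳ _)
    off : ∀ x → ¬ x F.≈ F.0# → atZero x ≈ 0#
    off x x≉0 with x F.≟ F.0#
    ... | yes x≈0 = ⊥-elim (x≉0 x≈0)
    ... | no  _   = refl
    on : ∀ x → x F.≈ F.0# → atZero x ≈ f F.0#
    on x x≈0 with x F.≟ F.0#
    ... | yes _   = f-resp x≈0
    ... | no  x≉0 = ⊥-elim (x≉0 x≈0)

  Σ*-cong : ∀ {f g} → (∀ x → ¬ x F.≈ F.0# → f x ≈ g x) → Σ* f ≈ Σ* g
  Σ*-cong {f} {g} f≈g = trans (Σ*-as-Σᶠ f) (trans (∑-cong F.elems same) (sym (Σ*-as-Σᶠ g)))
    where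
    same : ∀ x → offZero f x ≈ offZero g x
    same x with x F.≟ F.0#
    ... | yes _   = refl
    ... | no  x≉0 = f≈g x x≉0

  Σ*-point : ∀ {f y v} → ¬ y F.≈ F.0# → (∀ x → ¬ x F.≈ y → f x ≈ 0#) → (∀ x → x F.≈ y → f x ≈ v) →
    Σ* f ≈ v
  Σ*-point {f} {y} {v} y≉0 off-y at-y = trans (Σ*-as-Σᶠ f) (Σᶠ-point off on)
    where
    off : ∀ x → ¬ x F.≈ y → offZero f x ≈ 0#
    off x x≉y with x F.≟ F.0#
    ... | yes _ = refl
    ... | no  _ = off-y x x≉y
    on : ∀ x → x F.≈ y → offZero f x ≈ v
    on x x≈y with x F.≟ F.0#
    ... | yes x≈0 = ⊥-elim (y≉0 (F.trans (F.sym x≈y) x≈0))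
    ... | no  _   = at-y x x≈y

  -- Multiplication by a unit t permutes F^×: Σ* f = Σ*(a ↦ f(t a)).
  Σ*-scale : ∀ t → ¬ t F.≈ F.0# → ∀ {f} → Respectful f → Σ* f ≈ Σ* (λ a → f (t F.* a))
  Σ*-scale t t≉0 {f} f-resp = begin
    Σ* f                                      ≈⟨ Σ*-as-Σᶠ f ⟩
    Σᶠ (offZero f)                            ≈⟨ sym (Σᶠ-reindex (t F.*_) (t F.⁻¹ F.*_) F.*-congˡ F.*-congˡ
                                                   cancel cancel⁻ offZero-resp) ⟩
    Σᶠ (λ a → offZero f (t F.* a))            ≈⟨ ∑-cong F.elems scaled ⟩
    Σᶠ (offZero (λ a → f (t F.* a)))          ≈⟨ sym (Σ*-as-Σᶠ _) ⟩
    Σ* (λ a → f (t F.* a))                    ∎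
    where
    cancel : ∀ y → t F.* (t F.⁻¹ F.* y) F.≈ y
    cancel y = F.trans (F.sym (F.*-assoc _ _ _))
                 (F.trans (F.*-congʳ (F.⁻¹-inverseʳ t t≉0)) (F.*-identityˡ y))
    cancel⁻ : ∀ x → t F.⁻¹ F.* (t F.* x) F.≈ x
    cancel⁻ x = F.trans (F.sym (F.*-assoc _ _ _))
                  (F.trans (F.*-congʳ (FF.⁻¹-inverseˡ t t≉0)) (F.*-identityˡ x))
    offZero-resp : Respectful (offZero f)
    offZero-resp {x} {y} x≈y with x F.≟ F.0# | y F.≟ F.0#
    ... | yes _   | yes _   = refl
    ... | yes x≈0 | no  y≉0 = ⊥-elim (y≉0 (F.trans (F.sym x≈y) x≈0))
    ... | no  x≉0 | yes y≈0 = ⊥-elim (x≉0 (F.trans x≈y y≈0))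
    ... | no  _   | no  _   = f-resp x≈y
    -- t a = 0 exactly when a = 0
    scaled : ∀ a → offZero f (t F.* a) ≈ offZero (λ a → f (t F.* a)) a
    scaled a with (t F.* a) F.≟ F.0# | a F.≟ F.0#
    ... | yes _    | yes _   = refl
    ... | yes ta≈0 | no  a≉0 = ⊥-elim (a≉0 (FF.*-cancel-zero ta≈0 t≉0))
    ... | no  ta≉0 | yes a≈0 = ⊥-elim (ta≉0 (FF.*-zeroʳ t a≈0))
    ... | no  _    | no  _   = refl

module NatCounting where
  open import Algebra.Properties.Semiring.Mult (CommutativeSemiring.semiring ℕₚ.+-*-commutativeSemiring)
    renaming (_×_ to _·_)

  n·1≡n : ∀ n → n · 1 ≡ n
  n·1≡n zero    = ≡.refl
  n·1≡n (suc n) = ≡.cong suc (n·1≡n n)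

  card≡1+#units : (F : FiniteField) → FiniteField.card F ≡ suc (length (FiniteField.units F))
  card≡1+#units F = begin
    card                      ≡⟨ ≡.sym (n·1≡n card) ⟩
    card · 1                  ≡⟨ ≡.sym (∑-const elems 1) ⟩
    Σᶠ (λ _ → 1)              ≡⟨ Σᶠ-split (λ _ → ≡.refl) ⟩
    Σ* (λ _ → 1) ℕ.+ 1        ≡⟨ ≡.cong (ℕ._+ 1) (≡.trans (∑-const units 1) (n·1≡n (length units))) ⟩
    length units ℕ.+ 1        ≡⟨ ℕₚ.+-comm (length units) 1 ⟩
    suc (length units)        ∎
    where
    open FiniteField F using (card; elems; units)
    open ListSums ℕₚ.+-*-commutativeSemiring
    open FiniteFieldSums F ℕₚ.+-*-commutativeSemiring
    open ≡.≡-Reasoning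

-- The F-points of the twisted cubic V are (1 : s : s² : s³) for s ∈ F and
-- (0 : 0 : 0 : 1), so #V(F) = q + 1.
module TwistedCubicPoints (F : FiniteField) where
  open FiniteField F
  open TwistedCubic F
  private module FF = FieldFacts fld
  open NatCounting using (n·1≡n)

  data Normalized (a b c d : Carrier) : Set where
    lead₁ : a ≈ 1# → Normalized a b c d
    lead₂ : a ≈ 0# → b ≈ 1# → Normalized a b c d
    lead₃ : a ≈ 0# → b ≈ 0# → c ≈ 1# → Normalized a b c d
    lead₄ : a ≈ 0# → b ≈ 0# → c ≈ 0# → d ≈ 1# → Normalized a b c d

  module _ {a b c d : Carrier} where
    normalized-sound : T (normalized a b c d) → Normalized a b c d
    normalized-sound t with a ≟ 0# | a ≟ 1# | b ≟ 0# | b ≟ 1# | c ≟ 0# | c ≟ 1# | d ≟ 0# | d ≟ 1#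
    ... | no  _  | yes a≈1 | _ | _ | _ | _ | _ | _ = lead₁ a≈1
    ... | yes a≈0 | _ | no _ | yes b≈1 | _ | _ | _ | _ = lead₂ a≈0 b≈1
    ... | yes a≈0 | _ | yes b≈0 | _ | no _ | yes c≈1 | _ | _ = lead₃ a≈0 b≈0 c≈1
    ... | yes a≈0 | _ | yes b≈0 | _ | yes c≈0 | _ | no _ | yes d≈1 = lead₄ a≈0 b≈0 c≈0 d≈1

  Equations : Carrier → Carrier → Carrier → Carrier → Set
  Equations a b c d = f₁ a b c d ≈ 0# × f₂ a b c d ≈ 0# × f₃ a b c d ≈ 0#

  Affine Infinity : Carrier → Carrier → Carrier → Carrier → Set
  Affine   a b c d = a ≈ 1# × c ≈ b * b × d ≈ b * c
  Infinity a b c d = a ≈ 0# × b ≈ 0# × c ≈ 0# × d ≈ 1#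

  private
    one-times : ∀ {a} x → a ≈ 1# → a * x ≈ x
    one-times x a≈1 = trans (*-congʳ a≈1) (*-identityˡ x)

    vanish⇒ : ∀ {u v} → u - v ≈ 0# → u ≈ v
    vanish⇒ = FF.x∙y⁻¹≈ε⇒x≈y _ _

    ⇒vanish : ∀ {u v} → u ≈ v → u - v ≈ 0#
    ⇒vanish = FF.x≈y⇒x∙y⁻¹≈ε

    0-1≉0 : ∀ {u v} → u ≈ 0# → v ≈ 1# → ¬ u - v ≈ 0#
    0-1≉0 u≈0 v≈1 u-v≈0 = 0≉1 (trans (sym u≈0) (trans (vanish⇒ u-v≈0) v≈1))

  cubic-sound : ∀ {a b c d} → Normalized a b c d → Equations a b c d → Affine a b c d ⊎ Infinity a b c d
  cubic-sound {a} {b} {c} {d} (lead₁ a≈1) (e₁ , _ , e₃) =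
    inj₁ (a≈1 , trans (sym (one-times c a≈1)) (vanish⇒ e₁) , trans (sym (one-times d a≈1)) (vanish⇒ e₃))
  cubic-sound {a} {b} {c} (lead₂ a≈0 b≈1) (e₁ , _ , _) =
    ⊥-elim (0-1≉0 (FF.*-zeroˡ c a≈0) (trans (*-cong b≈1 b≈1) (*-identityˡ 1#)) e₁)
  cubic-sound {a} {b} {c} {d} (lead₃ _ b≈0 c≈1) (_ , e₂ , _) =
    ⊥-elim (0-1≉0 (FF.*-zeroˡ d b≈0) (trans (*-cong c≈1 c≈1) (*-identityˡ 1#)) e₂)
  cubic-sound (lead₄ a≈0 b≈0 c≈0 d≈1) _ = inj₂ (a≈0 , b≈0 , c≈0 , d≈1)

  affine-equations : ∀ {a b c d} → Affine a b c d → Equations a b c d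
  affine-equations {a} {b} {c} {d} (a≈1 , c≈b² , d≈bc) =
    ⇒vanish (trans (one-times c a≈1) c≈b²) , ⇒vanish b·d≈c·c , ⇒vanish (trans (one-times d a≈1) d≈bc)
    where
    b·d≈c·c : b * d ≈ c * c
    b·d≈c·c = trans (*-congˡ d≈bc) (trans (sym (*-assoc b b c)) (*-congʳ (sym c≈b²)))

  infinity-equations : ∀ {a b c d} → Infinity a b c d → Equations a b c d
  infinity-equations {a} {b} {c} {d} (a≈0 , b≈0 , c≈0 , _) =
    ⇒vanish (trans (FF.*-zeroˡ c a≈0) (sym (FF.*-zeroˡ b b≈0))) ,
    ⇒vanish (trans (FF.*-zeroˡ d b≈0) (sym (FF.*-zeroˡ c c≈0))) ,
    ⇒vanish (trans (FF.*-zeroˡ d a≈0) (sym (FF.*-zeroˡ c b≈0)))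

  module _ {a b c d : Carrier} where
    affine-normalized : a ≈ 1# → T (normalized a b c d)
    affine-normalized a≈1 with a ≟ 0# | a ≟ 1#
    ... | yes a≈0 | _     = ⊥-elim (0≉1 (trans (sym a≈0) a≈1))
    ... | no _    | yes _ = _
    ... | no _    | no a≉1 = ⊥-elim (a≉1 a≈1)

    infinity-normalized : Infinity a b c d → T (normalized a b c d)
    infinity-normalized (a≈0 , b≈0 , c≈0 , d≈1) with a ≟ 0# | b ≟ 0# | c ≟ 0# | d ≟ 0# | d ≟ 1#
    ... | no a≉0 | _      | _      | _       | _      = ⊥-elim (a≉0 a≈0)
    ... | yes _  | no b≉0 | _      | _       | _      = ⊥-elim (b≉0 b≈0)
    ... | yes _  | yes _  | no c≉0 | _       | _      = ⊥-elim (c≉0 c≈0)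
    ... | yes _  | yes _  | yes _  | yes d≈0 | _      = ⊥-elim (0≉1 (trans (sym d≈0) d≈1))
    ... | yes _  | yes _  | yes _  | no _    | no d≉1 = ⊥-elim (d≉1 d≈1)
    ... | yes _  | yes _  | yes _  | no _    | yes _  = _

  isPoint : Carrier → Carrier → Carrier → Carrier → Bool
  isPoint a b c d = normalized a b c d ∧ foldr (λ f r → isZero (f a b c d) ∧ r) true (f₁ ∷ f₂ ∷ f₃ ∷ [])

  IsPoint : Carrier → Carrier → Carrier → Carrier → Set
  IsPoint a b c d = T (isPoint a b c d)

  module _ {a b c d : Carrier} where
    private
      EqTest : Set
      EqTest = T (foldr (λ f r → isZero (f a b c d) ∧ r) true (f₁ ∷ f₂ ∷ f₃ ∷ []))

      equations-sound : EqTest → Equations a b c d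
      equations-sound t with f₁ a b c d ≟ 0# | f₂ a b c d ≟ 0# | f₃ a b c d ≟ 0#
      ... | yes e₁ | yes e₂ | yes e₃ = e₁ , e₂ , e₃

      equations-complete : Equations a b c d → EqTest
      equations-complete (e₁ , e₂ , e₃) with f₁ a b c d ≟ 0# | f₂ a b c d ≟ 0# | f₃ a b c d ≟ 0#
      ... | no ¬e₁ | _      | _      = ⊥-elim (¬e₁ e₁)
      ... | yes _  | no ¬e₂ | _      = ⊥-elim (¬e₂ e₂)
      ... | yes _  | yes _  | no ¬e₃ = ⊥-elim (¬e₃ e₃)
      ... | yes _  | yes _  | yes _  = _

    isPoint-sound : IsPoint a b c d → Affine a b c d ⊎ Infinity a b c d
    isPoint-sound t = cubic-sound (normalized-sound n) (equations-sound e)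
      where open Equivalence T-∧ using (to)
            n = proj₁ (to t)
            e = proj₂ (to t)

    isPoint-complete : Affine a b c d ⊎ Infinity a b c d → IsPoint a b c d
    isPoint-complete (inj₁ aff) = from (affine-normalized (proj₁ aff) , equations-complete (affine-equations aff))
      where open Equivalence T-∧ using (from)
    isPoint-complete (inj₂ inf) = from (infinity-normalized inf , equations-complete (infinity-equations inf))
      where open Equivalence T-∧ using (from)

  affine? : ∀ a b c d → Dec (Affine a b c d)
  affine? a b c d = a ≟ 1# ×-dec c ≟ (b * b) ×-dec d ≟ (b * c)

  infinity? : ∀ a b c d → Dec (Infinity a b c d)
  infinity? a b c d = a ≟ 0# ×-dec b ≟ 0# ×-dec c ≟ 0# ×-dec d ≟ 1#

  private
    open ListSums ℕₚ.+-*-commutativeSemiring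
    open FiniteFieldSums F ℕₚ.+-*-commutativeSemiring
    open ≡.≡-Reasoning

    Σ⁴ : (Carrier → Carrier → Carrier → Carrier → ℕ) → ℕ
    Σ⁴ f = Σᶠ λ a → Σᶠ λ b → Σᶠ λ c → Σᶠ λ d → f a b c d

    Σ⁴-cong : ∀ {f g} → (∀ a b c d → f a b c d ≡ g a b c d) → Σ⁴ f ≡ Σ⁴ g
    Σ⁴-cong f≡g = ∑-cong elems λ a → ∑-cong elems λ b → ∑-cong elems λ c → ∑-cong elems λ d → f≡g a b c d

    Σ⁴-+ : ∀ f g → Σ⁴ (λ a b c d → f a b c d ℕ.+ g a b c d) ≡ Σ⁴ f ℕ.+ Σ⁴ g
    Σ⁴-+ f g = ≡.trans (∑-cong elems λ a → ≡.trans (∑-cong elems λ b → ≡.trans (∑-cong elems λ c →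
      ∑-+ elems _ _) (∑-+ elems _ _)) (∑-+ elems _ _)) (∑-+ elems _ _)

    zero⁴ : ∀ {f : Carrier → Carrier → Carrier → ℕ} → (∀ b c d → f b c d ≡ 0) →
      Σᶠ (λ b → Σᶠ λ c → Σᶠ λ d → f b c d) ≡ 0
    zero⁴ f≡0 = ∑-zero elems λ b → ∑-zero elems λ c → ∑-zero elems λ d → f≡0 b c d

    #V-as-sum : #V ≡ Σ⁴ (λ a b c d → 𝟙 (T? (isPoint a b c d)))
    #V-as-sum = ≡.trans (≡.sym (n·1≡n #V)) (≡.trans (length-filter _ quads)
      (≡.trans (∑-concatMap elems _ _) (∑-cong elems λ a →
        ≡.trans (∑-concatMap elems _ _) (∑-cong elems λ b →
          ≡.trans (∑-concatMap elems _ _) (∑-cong elems λ c → ∑-map elems _ _)))))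

    -- exactly one of the two kinds of point is met, since 0 ≉ 1
    point-indicator : ∀ a b c d → 𝟙 (T? (isPoint a b c d)) ≡ 𝟙 (infinity? a b c d) ℕ.+ 𝟙 (affine? a b c d)
    point-indicator a b c d = 𝟙-⊎ (T? _) (infinity? a b c d) (affine? a b c d)
      (λ p → swap (isPoint-sound p)) (λ p → isPoint-complete (swap p))
      (λ (inf , aff) → 0≉1 (trans (sym (proj₁ inf)) (proj₁ aff)))

    -- one affine point for every s = b ∈ F
    affine-count : Σ⁴ (λ a b c d → 𝟙 (affine? a b c d)) ≡ card
    affine-count = Σᶠ-point off-1 at-1
      where
      off-1 : ∀ a → ¬ a ≈ 1# → Σᶠ (λ b → Σᶠ λ c → Σᶠ λ d → 𝟙 (affine? a b c d)) ≡ 0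
      off-1 a a≉1 = zero⁴ λ b c d → 𝟙-no (affine? a b c d) (λ aff → a≉1 (proj₁ aff))
      at-1 : ∀ a → a ≈ 1# → Σᶠ (λ b → Σᶠ λ c → Σᶠ λ d → 𝟙 (affine? a b c d)) ≡ card
      at-1 a a≈1 = ≡.trans (∑-cong elems one) (≡.trans (∑-const elems 1) (n·1≡n card))
        where
        one : ∀ b → Σᶠ (λ c → Σᶠ λ d → 𝟙 (affine? a b c d)) ≡ 1
        one b = Σᶠ-point (λ c c≉b² → ∑-zero elems λ d → 𝟙-no (affine? a b c d) (λ aff → c≉b² (proj₁ (proj₂ aff))))
          λ c c≈b² → Σᶠ-point (λ d d≉bc → 𝟙-no (affine? a b c d) (λ aff → d≉bc (proj₂ (proj₂ aff))))
            λ d d≈bc → 𝟙-yes (affine? a b c d) (a≈1 , c≈b² , d≈bc)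

    infinity-count : Σ⁴ (λ a b c d → 𝟙 (infinity? a b c d)) ≡ 1
    infinity-count =
      Σᶠ-point (λ a a≉0 → zero⁴ λ b c d → 𝟙-no (infinity? a b c d) (λ inf → a≉0 (proj₁ inf))) λ a a≈0 →
      Σᶠ-point (λ b b≉0 → ∑-zero elems λ c → ∑-zero elems λ d →
                 𝟙-no (infinity? a b c d) (λ inf → b≉0 (proj₁ (proj₂ inf)))) λ b b≈0 →
      Σᶠ-point (λ c c≉0 → ∑-zero elems λ d → 𝟙-no (infinity? a b c d) (λ inf → c≉0 (proj₁ (proj₂ (proj₂ inf)))))
        λ c c≈0 →
      Σᶠ-point (λ d d≉1 → 𝟙-no (infinity? a b c d) (λ inf → d≉1 (proj₂ (proj₂ (proj₂ inf)))))
        λ d d≈1 → 𝟙-yes (infinity? a b c d) (a≈0 , b≈0 , c≈0 , d≈1)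

  #V≡1+q : #V ≡ suc card
  #V≡1+q = begin
    #V                                                                    ≡⟨ #V-as-sum ⟩
    Σ⁴ (λ a b c d → 𝟙 (T? (isPoint a b c d)))                             ≡⟨ Σ⁴-cong point-indicator ⟩
    Σ⁴ (λ a b c d → 𝟙 (infinity? a b c d) ℕ.+ 𝟙 (affine? a b c d))         ≡⟨ Σ⁴-+ _ _ ⟩
    Σ⁴ (λ a b c d → 𝟙 (infinity? a b c d)) ℕ.+ Σ⁴ (λ a b c d → 𝟙 (affine? a b c d))
                                                                          ≡⟨ ≡.cong₂ ℕ._+_ infinity-count affine-count ⟩
    suc card                                                              ∎

module CharacterSums (F : FiniteField) (K : Field) (θ : FiniteField.Carrier F → Field.Carrier K)
                     (χ : NontrivialAdditiveCharacter F K θ) where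
  private
    module F  = FiniteField F
    module FF = FieldFacts F.fld
    module KF = FieldFacts K
    module χ  = NontrivialAdditiveCharacter χ
  open Field K
  open ListSums commutativeSemiring
  open FiniteFieldSums F commutativeSemiring
  open IntegerRingSolver commRing using (solve; _:=_; _:+_; _:-_; _:*_; :-_; #_)
  open import Algebra.Properties.Semiring.Mult semiring renaming (_×_ to _·_)
  open import Relation.Binary.Reasoning.Setoid setoid

  θ-0 : θ F.0# ≈ 1#
  θ-0 = KF.idempotent⇒1 (χ.nonzero F.0#) (trans (χ.cong (F.sym (F.+-identityʳ F.0#))) (χ.hom F.0# F.0#))

  -- orthogonality: θ(x₀) Σ θ = Σ θ(x₀ + x) = Σ θ with θ(x₀) ≠ 1, hence Σ θ = 0
  Σθ≈0 : Σᶠ θ ≈ 0#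
  Σθ≈0 = KF.*-cancel-zero (begin
    (θ x₀ - 1#) * Σᶠ θ         ≈⟨ solve 2 (λ u s → (u :- # 1) :* s := u :* s :- s) refl (θ x₀) (Σᶠ θ) ⟩
    θ x₀ * Σᶠ θ - Σᶠ θ         ≈⟨ +-congʳ shift-invariant ⟩
    Σᶠ θ - Σᶠ θ                ≈⟨ -‿inverseʳ _ ⟩
    0#                         ∎) θx₀-1≉0
    where
    x₀ = proj₁ χ.nontrivial
    θx₀-1≉0 : ¬ θ x₀ - 1# ≈ 0#
    θx₀-1≉0 e = proj₂ χ.nontrivial (KF.x∙y⁻¹≈ε⇒x≈y _ _ e)
    shift-invariant : θ x₀ * Σᶠ θ ≈ Σᶠ θ
    shift-invariant = begin
      θ x₀ * Σᶠ θ                ≈⟨ sym (∑-*ˡ F.elems _ θ) ⟩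
      Σᶠ (λ x → θ x₀ * θ x)      ≈⟨ sym (∑-cong F.elems (χ.hom x₀)) ⟩
      Σᶠ (λ x → θ (x₀ F.+ x))    ≈⟨ Σᶠ-reindex (x₀ F.+_) (λ y → y F.- x₀) F.+-congˡ F.+-congʳ
                                     translate translate⁻ χ.cong ⟩
      Σᶠ θ                       ∎
      where
      translate : ∀ y → x₀ F.+ (y F.- x₀) F.≈ y
      translate y = F.trans (F.+-congˡ (F.+-comm y (F.- x₀))) (F.trans (F.sym (F.+-assoc _ _ _))
                      (F.trans (F.+-congʳ (F.-‿inverseʳ x₀)) (F.+-identityˡ y)))
      translate⁻ : ∀ x → (x₀ F.+ x) F.- x₀ F.≈ x
      translate⁻ x = F.trans (F.+-congʳ (F.+-comm x₀ x)) (F.trans (F.+-assoc _ _ _)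
                       (F.trans (F.+-congˡ (F.-‿inverseʳ x₀)) (F.+-identityʳ x)))

  Σθ-scaled : ∀ c (c? : Dec (c F.≈ F.0#)) → Σᶠ (λ t → θ (t F.* c)) ≈ ι F.card * 𝟙 c?
  Σθ-scaled c (yes c≈0) = begin
    Σᶠ (λ t → θ (t F.* c))   ≈⟨ ∑-cong F.elems (λ t → trans (χ.cong (FF.*-zeroʳ t c≈0)) θ-0) ⟩
    Σᶠ (λ _ → 1#)            ≈⟨ ∑-const F.elems 1# ⟩
    F.card · 1#              ≈⟨ sym (KF.ι≈×1 F.card) ⟩
    ι F.card                 ≈⟨ sym (*-identityʳ _) ⟩
    ι F.card * 1#            ∎
  Σθ-scaled c (no c≉0) = begin
    Σᶠ (λ t → θ (t F.* c))   ≈⟨ Σᶠ-reindex (F._* c) (F._* (c F.⁻¹)) F.*-congʳ F.*-congʳ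
                                  cancel cancel⁻ χ.cong ⟩
    Σᶠ θ                     ≈⟨ Σθ≈0 ⟩
    0#                       ≈⟨ sym (zeroʳ _) ⟩
    ι F.card * 0#            ∎
    where
    cancel : ∀ y → (y F.* c F.⁻¹) F.* c F.≈ y
    cancel y = F.trans (F.*-assoc _ _ _) (F.trans (F.*-congˡ (FF.⁻¹-inverseˡ c c≉0)) (F.*-identityʳ y))
    cancel⁻ : ∀ x → (x F.* c) F.* c F.⁻¹ F.≈ x
    cancel⁻ x = F.trans (F.*-assoc _ _ _) (F.trans (F.*-congˡ (F.⁻¹-inverseʳ c c≉0)) (F.*-identityʳ x))

  -- Σ_{t∈F^×} θ(t c) = -1 + q [c = 0]: remove the term θ(0) = 1
  Σ*θ-scaled : ∀ c → Σ* (λ t → θ (t F.* c)) ≈ - 1# + ι F.card * 𝟙 (c F.≟ F.0#)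
  Σ*θ-scaled c = begin
    Σ* θc                        ≈⟨ solve 1 (λ x → x := :- # 1 :+ (x :+ # 1)) refl (Σ* θc) ⟩
    - 1# + (Σ* θc + 1#)          ≈⟨ +-congˡ (+-congˡ (sym (trans (χ.cong (F.zeroˡ c)) θ-0))) ⟩
    - 1# + (Σ* θc + θc F.0#)     ≈⟨ +-congˡ (sym (Σᶠ-split (λ e → χ.cong (F.*-congʳ e)))) ⟩
    - 1# + Σᶠ θc                 ≈⟨ +-congˡ (Σθ-scaled c (c F.≟ F.0#)) ⟩
    - 1# + ι F.card * 𝟙 (c F.≟ F.0#) ∎
    where
    θc : F.Carrier → Carrier
    θc t = θ (t F.* c)

-- Polynomial identities behind the substitution t₁ = t a, t₃ = t b in the
-- phase of L (valid in any commutative ring; s stands for t⁻¹).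
module PhaseIdentities {c ℓ : Level} (R : CommutativeRing c ℓ) where
  open CommutativeRing R
  open IntegerRingSolver R

  g : Carrier → Carrier → Carrier
  g a b = (1# - a * b) * ((1# + a) * (1# + b))

  -- the phase at (ta, t, tb) divided by t, as a polynomial in u = t t⁻¹
  core : Carrier → Carrier → Carrier → Carrier
  core a b u = ((a + 1# + b) - (u * u) * (a * a * b)) - (u * u * u) * (a * a * b * b) - (u * u) * (a * b * b)

  core-cong : ∀ a b {u v} → u ≈ v → core a b u ≈ core a b v
  core-cong a b e = +-cong (+-cong (+-congˡ (-‿cong (*-congʳ (*-cong e e))))
                                   (-‿cong (*-congʳ (*-cong (*-cong e e) e))))
                           (-‿cong (*-congʳ (*-cong e e)))

  phase-expansion : ∀ t s a b →
    (t * a) + t + (t * b)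
      - ((t * a) * (t * a)) * (s * s) * (t * b)
      - ((t * a) * (t * a)) * (s * s * s) * ((t * b) * (t * b))
      - (t * a) * (s * s) * ((t * b) * (t * b))
    ≈ t * core a b (t * s)
  phase-expansion = solve 4 (λ t s a b →
      (t :* a) :+ t :+ (t :* b)
        :- ((t :* a) :* (t :* a)) :* (s :* s) :* (t :* b)
        :- ((t :* a) :* (t :* a)) :* (s :* s :* s) :* ((t :* b) :* (t :* b))
        :- (t :* a) :* (s :* s) :* ((t :* b) :* (t :* b))
      := t :* (((a :+ # 1 :+ b) :- ((t :* s) :* (t :* s)) :* (a :* a :* b))
                 :- ((t :* s) :* (t :* s) :* (t :* s)) :* (a :* a :* b :* b)
                 :- ((t :* s) :* (t :* s)) :* (a :* b :* b))) refl

  core-at-1 : ∀ a b → core a b 1# ≈ g a b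
  core-at-1 = solve 2 (λ a b →
      ((a :+ # 1 :+ b) :- (# 1 :* # 1) :* (a :* a :* b))
        :- (# 1 :* # 1 :* # 1) :* (a :* a :* b :* b)
        :- (# 1 :* # 1) :* (a :* b :* b)
      := (# 1 :- a :* b) :* ((# 1 :+ a) :* (# 1 :+ b))) refl

  -- the first and last factor of g cannot vanish together unless 1 + a does
  1+a-split : ∀ a b → 1# + a ≈ (1# - a * b) + a * (1# + b)
  1+a-split = solve 2 (λ a b → # 1 :+ a := (# 1 :- a :* b) :+ a :* (# 1 :+ b)) refl

-- Substituting t₁ = t₂ a, t₃ = t₂ b turns the phase into
-- t₂ g(a,b) with g(a,b) = (1 - ab)(1 + a)(1 + b), so summing over t₂ first
--   L = Σ_{a,b ∈ F^×} (-1 + q [g(a,b) = 0]),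
-- and g(a,·) has two zeros on F^× (b = a⁻¹ and b = -1) unless a = -1, where
-- it vanishes identically.  With u = q - 1 this gives
--   L = -u² + q (3u - 2).
module ExponentialSum (F : FiniteField) (K : Field) (θ : FiniteField.Carrier F → Field.Carrier K)
                      (χ : NontrivialAdditiveCharacter F K θ) where
  private
    module F  = FiniteField F
    module FF = FieldFacts F.fld
    module KF = FieldFacts K
    module χ  = NontrivialAdditiveCharacter χ
  open Field K
  open ListSums commutativeSemiring
  open FiniteFieldSums F commutativeSemiring
  open CharacterSums F K θ χ
  open ExpSum F K θ using (phase; L)
  open PhaseIdentities F.commRing using (g; core-cong; phase-expansion; core-at-1; 1+a-split)
  open import Algebra.Properties.Semiring.Mult semiring using (×-assoc-*; ×-congʳ) renaming (_×_ to _·_)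
  open import Relation.Binary.Reasoning.Setoid setoid

  U : Carrier
  U = ι (length F.units)

  q≈1+U : ι F.card ≈ 1# + U
  q≈1+U = reflexive (≡.cong ι (NatCounting.card≡1+#units F))

  Σ*-const : ∀ c → Σ* (λ _ → c) ≈ U * c
  Σ*-const c = begin
    Σ* (λ _ → c)               ≈⟨ ∑-const F.units c ⟩
    length F.units · c         ≈⟨ ×-congʳ (length F.units) (*-identityˡ c) ⟨
    length F.units · (1# * c)  ≈⟨ ×-assoc-* (length F.units) 1# c ⟨
    length F.units · 1# * c    ≈⟨ *-congʳ (KF.ι≈×1 (length F.units)) ⟨
    U * c                      ∎

  Σ*-affine : ∀ c d h → Σ* (λ x → c + d * h x) ≈ U * c + d * Σ* h
  Σ*-affine c d h = trans (∑-+ F.units _ _) (+-cong (Σ*-const c) (∑-*ˡ F.units d h))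

  phase-homogeneous : ∀ t a b → ¬ t F.≈ F.0# → phase (t F.* a) t (t F.* b) F.≈ t F.* g a b
  phase-homogeneous t a b t≉0 = F.trans (phase-expansion t (t F.⁻¹) a b)
    (F.*-congˡ (F.trans (core-cong a b (F.⁻¹-inverseʳ t t≉0)) (core-at-1 a b)))

  Σ*-zeros-1+b : Σ* (λ b → 𝟙 ((F.1# F.+ b) F.≟ F.0#)) ≈ 1#
  Σ*-zeros-1+b = Σ*-point -1≉0
    (λ b b≉-1 → 𝟙-no ((F.1# F.+ b) F.≟ F.0#) (λ 1+b≈0 → b≉-1 (GP.inverseʳ-unique F.+-group F.1# b 1+b≈0)))
    (λ b b≈-1 → 𝟙-yes ((F.1# F.+ b) F.≟ F.0#) (F.trans (F.+-congˡ b≈-1) (F.-‿inverseʳ F.1#)))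
    where
    import Algebra.Properties.Group as GP
    -1≉0 : ¬ F.- F.1# F.≈ F.0#
    -1≉0 -1≈0 = F.0≉1 (F.sym (F.trans (F.sym (F.+-identityʳ F.1#))
                                 (F.trans (F.+-congˡ (F.sym -1≈0)) (F.-‿inverseʳ F.1#))))

  Σ*-zeros-1-ab : ∀ a → ¬ a F.≈ F.0# → Σ* (λ b → 𝟙 ((F.1# F.- a F.* b) F.≟ F.0#)) ≈ 1#
  Σ*-zeros-1-ab a a≉0 = Σ*-point (FF.⁻¹-nonzero a≉0)
    (λ b b≉a⁻¹ → 𝟙-no ((F.1# F.- a F.* b) F.≟ F.0#) (λ 1-ab≈0 → b≉a⁻¹ (FF.inverse-unique a≉0 (F.sym (FF.x∙y⁻¹≈ε⇒x≈y _ _ 1-ab≈0)))))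
    (λ b b≈a⁻¹ → 𝟙-yes ((F.1# F.- a F.* b) F.≟ F.0#) (FF.x≈y⇒x∙y⁻¹≈ε (F.sym (F.trans (F.*-congˡ b≈a⁻¹) (F.⁻¹-inverseʳ a a≉0)))))

  𝟙-zero-product : ∀ {u v w} → ¬ v F.≈ F.0# → ¬ (u F.≈ F.0# × w F.≈ F.0#) →
    𝟙 ((u F.* (v F.* w)) F.≟ F.0#) ≈ 𝟙 (u F.≟ F.0#) + 𝟙 (w F.≟ F.0#)
  𝟙-zero-product {u} {v} {w} v≉0 not-both = 𝟙-⊎ ((u F.* (v F.* w)) F.≟ F.0#) (u F.≟ F.0#) (w F.≟ F.0#) factor vanish not-both
    where
    factor : u F.* (v F.* w) F.≈ F.0# → u F.≈ F.0# ⊎ w F.≈ F.0#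
    factor uvw≈0 with u F.≟ F.0#
    ... | yes u≈0 = inj₁ u≈0
    ... | no  u≉0 = inj₂ (FF.*-cancel-zero (FF.*-cancel-zero uvw≈0 u≉0) v≉0)
    vanish : u F.≈ F.0# ⊎ w F.≈ F.0# → u F.* (v F.* w) F.≈ F.0#
    vanish (inj₁ u≈0) = FF.*-zeroˡ (v F.* w) u≈0
    vanish (inj₂ w≈0) = FF.*-zeroʳ u (FF.*-zeroʳ v w≈0)

  Σ*-zeros-g : ∀ a → ¬ a F.≈ F.0# → (d : Dec ((F.1# F.+ a) F.≈ F.0#)) →
    Σ* (λ b → 𝟙 (g a b F.≟ F.0#)) ≈ (1# + 1#) + 𝟙 d * (U - (1# + 1#))
  Σ*-zeros-g a a≉0 (yes 1+a≈0) = begin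
    Σ* (λ b → 𝟙 (g a b F.≟ F.0#))     ≈⟨ Σ*-cong (λ b _ → 𝟙-yes (g a b F.≟ F.0#) (vanishes b)) ⟩
    Σ* (λ _ → 1#)                     ≈⟨ Σ*-const 1# ⟩
    U * 1#                            ≈⟨ solve 1 (λ u → u :* # 1 := # 2 :+ # 1 :* (u :- # 2)) refl U ⟩
    (1# + 1#) + 1# * (U - (1# + 1#))  ∎
    where
    open IntegerRingSolver commRing
    vanishes : ∀ b → g a b F.≈ F.0#
    vanishes b = FF.*-zeroʳ (F.1# F.- a F.* b) (FF.*-zeroˡ (F.1# F.+ b) 1+a≈0)
  Σ*-zeros-g a a≉0 (no 1+a≉0) = begin
    Σ* (λ b → 𝟙 (g a b F.≟ F.0#))      ≈⟨ Σ*-cong (λ b _ → 𝟙-zero-product 1+a≉0 (not-both b)) ⟩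
    Σ* (λ b → 𝟙 ((F.1# F.- a F.* b) F.≟ F.0#) + 𝟙 ((F.1# F.+ b) F.≟ F.0#))
                                       ≈⟨ ∑-+ F.units _ _ ⟩
    Σ* (λ b → 𝟙 ((F.1# F.- a F.* b) F.≟ F.0#)) + Σ* (λ b → 𝟙 ((F.1# F.+ b) F.≟ F.0#))
                                       ≈⟨ +-cong (Σ*-zeros-1-ab a a≉0) Σ*-zeros-1+b ⟩
    1# + 1#                            ≈⟨ solve 1 (λ u → # 1 :+ # 1 := # 2 :+ # 0 :* (u :- # 2)) refl U ⟩
    (1# + 1#) + 0# * (U - (1# + 1#))   ∎
    where
    open IntegerRingSolver commRing
    -- 1 + a = (1 - ab) + a(1 + b)
    not-both : ∀ b → ¬ ((F.1# F.- a F.* b) F.≈ F.0# × (F.1# F.+ b) F.≈ F.0#)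
    not-both b (1-ab≈0 , 1+b≈0) = 1+a≉0 (F.trans (1+a-split a b)
      (F.trans (F.+-cong 1-ab≈0 (FF.*-zeroʳ a 1+b≈0)) (F.+-identityʳ F.0#)))

  L-as-sum : L ≈ Σ* λ t₁ → Σ* λ t₂ → Σ* λ t₃ → θ (phase t₁ t₂ t₃)
  L-as-sum = trans (reflexive (foldr-+ (concatMap plane F.units)))
    (trans (∑-concatMap F.units plane (λ x → x))
      (∑-cong F.units λ t₁ → trans (∑-concatMap F.units (line t₁) (λ x → x))
        (∑-cong F.units λ t₂ → reflexive (∑-map F.units (λ t₃ → θ (phase t₁ t₂ t₃)) (λ x → x)))))
    where
    line : F.Carrier → F.Carrier → List Carrier
    line t₁ t₂ = map (λ t₃ → θ (phase t₁ t₂ t₃)) F.units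
    plane : F.Carrier → List Carrier
    plane t₁ = concatMap (line t₁) F.units

  phase-cong : ∀ {x x′ y z z′} → x F.≈ x′ → z F.≈ z′ → phase x y z F.≈ phase x′ y z′
  phase-cong x≈ z≈ = F.+-cong (F.+-cong (F.+-cong (F.+-cong (F.+-congʳ x≈) z≈)
      (F.-‿cong (F.*-cong (F.*-congʳ (F.*-cong x≈ x≈)) z≈)))
      (F.-‿cong (F.*-cong (F.*-congʳ (F.*-cong x≈ x≈)) (F.*-cong z≈ z≈))))
      (F.-‿cong (F.*-cong (F.*-congʳ x≈) (F.*-cong z≈ z≈)))

  substitute : ∀ t → ¬ t F.≈ F.0# →
    Σ* (λ t₁ → Σ* λ t₃ → θ (phase t₁ t t₃)) ≈ Σ* (λ a → Σ* λ b → θ (t F.* g a b))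
  substitute t t≉0 = begin
    Σ* (λ t₁ → Σ* λ t₃ → θ (phase t₁ t t₃))
      ≈⟨ Σ*-scale t t≉0 (λ x≈ → ∑-cong F.units λ t₃ → χ.cong (phase-cong x≈ F.refl)) ⟩
    Σ* (λ a → Σ* λ t₃ → θ (phase (t F.* a) t t₃))
      ≈⟨ ∑-cong F.units (λ a → Σ*-scale t t≉0 (λ z≈ → χ.cong (phase-cong F.refl z≈))) ⟩
    Σ* (λ a → Σ* λ b → θ (phase (t F.* a) t (t F.* b)))
      ≈⟨ ∑-cong F.units (λ a → ∑-cong F.units λ b → χ.cong (phase-homogeneous t a b t≉0)) ⟩
    Σ* (λ a → Σ* λ b → θ (t F.* g a b)) ∎

  L-value : L ≈ U * (U * - 1# + (1# + U) * (1# + 1#)) + (1# + U) * (U - (1# + 1#))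
  L-value = begin
    L                                                      ≈⟨ L-as-sum ⟩
    Σ* (λ t₁ → Σ* λ t₂ → Σ* λ t₃ → θ (phase t₁ t₂ t₃))      ≈⟨ ∑-swap F.units F.units _ ⟩
    Σ* (λ t₂ → Σ* λ t₁ → Σ* λ t₃ → θ (phase t₁ t₂ t₃))      ≈⟨ Σ*-cong substitute ⟩
    Σ* (λ t → Σ* λ a → Σ* λ b → θ (t F.* g a b))           ≈⟨ ∑-swap F.units F.units _ ⟩
    Σ* (λ a → Σ* λ t → Σ* λ b → θ (t F.* g a b))           ≈⟨ ∑-cong F.units (λ a → ∑-swap F.units F.units _) ⟩
    Σ* (λ a → Σ* λ b → Σ* λ t → θ (t F.* g a b))           ≈⟨ ∑-cong F.units (λ a → ∑-cong F.units λ b →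
                                                                Σ*θ-scaled (g a b)) ⟩
    Σ* (λ a → Σ* λ b → - 1# + Q * 𝟙 (g a b F.≟ F.0#))      ≈⟨ ∑-cong F.units (λ a → Σ*-affine _ _ _) ⟩
    Σ* (λ a → U * - 1# + Q * Σ* (λ b → 𝟙 (g a b F.≟ F.0#)))
                                                           ≈⟨ Σ*-cong (λ a a≉0 → +-congˡ (*-congˡ
                                                                (Σ*-zeros-g a a≉0 ((F.1# F.+ a) F.≟ F.0#)))) ⟩
    Σ* (λ a → U * - 1# + Q * (two + 𝟙 ((F.1# F.+ a) F.≟ F.0#) * (U - two)))
                                                           ≈⟨ ∑-cong F.units (λ a → regroup (𝟙 ((F.1# F.+ a) F.≟ F.0#))) ⟩
    Σ* (λ a → (U * - 1# + Q * two) + (Q * (U - two)) * 𝟙 ((F.1# F.+ a) F.≟ F.0#))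
                                                           ≈⟨ Σ*-affine _ _ _ ⟩
    U * (U * - 1# + Q * two) + (Q * (U - two)) * Σ* (λ a → 𝟙 ((F.1# F.+ a) F.≟ F.0#))
                                                           ≈⟨ +-congˡ (*-congˡ Σ*-zeros-1+b) ⟩
    U * (U * - 1# + Q * two) + (Q * (U - two)) * 1#        ≈⟨ +-cong (*-congˡ (+-congˡ (*-congʳ q≈1+U)))
                                                                (trans (*-identityʳ _) (*-congʳ q≈1+U)) ⟩
    U * (U * - 1# + (1# + U) * two) + (1# + U) * (U - two) ∎
    where
    open IntegerRingSolver commRing
    Q two : Carrier
    Q   = ι F.card
    two = 1# + 1#
    regroup : ∀ δ → U * - 1# + Q * (two + δ * (U - two)) ≈ (U * - 1# + Q * two) + (Q * (U - two)) * δ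
    regroup δ = solve 3 (λ u q d → u :* (:- # 1) :+ q :* (# 2 :+ d :* (u :- # 2))
                         := (u :* (:- # 1) :+ q :* # 2) :+ (q :* (u :- # 2)) :* d)
                        refl U Q δ

-- The final computation in K: with q = 1 + u ≠ 0 and L = u(2q - u) + q(u - 2),
-- one has (u L - 1)/q = 2u² - u - 1, and the claimed right-hand side is q + 1.
module ClosedForm (K : Field) where
  open Field K
  open IntegerRingSolver commRing
  open import Algebra.Properties.Monoid.Mult.TCOptimised +-monoid using (×ᵤ≈×)
  open import Relation.Binary.Reasoning.Setoid setoid

  private
    ι≈⟦⟧ : ∀ n → ι n ≈ ⟦ + n ⟧
    ι≈⟦⟧ n = trans (FieldFacts.ι≈×1 K n) (×ᵤ≈× n 1#)

  closed-form : ∀ {U L} → ¬ 1# + U ≈ 0# →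
    L ≈ U * (U * - 1# + (1# + U) * (1# + 1#)) + (1# + U) * (U - (1# + 1#)) →
    1# + (1# + U) ≈ (((- (ι 2 * (1# + U) * (1# + U))) + ι 6 * (1# + U)) - 1#) + ((U * L) - 1#) * ((1# + U) ⁻¹)
  closed-form {U} {L} q≉0 L≈ = begin
    1# + Q                                                    ≈⟨ polynomial U ⟩
    ((- (⟦ + 2 ⟧ * Q * Q) + ⟦ + 6 ⟧ * Q) - 1#) + Y             ≈⟨ +-cong (+-congʳ (+-cong
                                                                   (-‿cong (*-congʳ (*-congʳ (sym (ι≈⟦⟧ 2)))))
                                                                   (*-congʳ (sym (ι≈⟦⟧ 6))))) (sym quotient) ⟩
    ((- (ι 2 * Q * Q) + ι 6 * Q) - 1#) + ((U * L) - 1#) * Q ⁻¹ ∎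
    where
    Q Y : Carrier
    Q = 1# + U
    Y = ((1# + 1#) * U * U - U) - 1#
    polynomial : ∀ u → 1# + (1# + u) ≈ ((- (⟦ + 2 ⟧ * (1# + u) * (1# + u)) + ⟦ + 6 ⟧ * (1# + u)) - 1#)
                                        + (((1# + 1#) * u * u - u) - 1#)
    polynomial = solve 1 (λ u → # 1 :+ (# 1 :+ u) :=
      ((:- (# 2 :* (# 1 :+ u) :* (# 1 :+ u)) :+ # 6 :* (# 1 :+ u)) :- # 1)
        :+ ((# 2 :* u :* u :- u) :- # 1)) refl
    quotient : ((U * L) - 1#) * Q ⁻¹ ≈ Y
    quotient = begin
      ((U * L) - 1#) * Q ⁻¹    ≈⟨ *-congʳ (+-congʳ (*-congˡ L≈)) ⟩
      ((U * (U * (U * - 1# + Q * (1# + 1#)) + Q * (U - (1# + 1#)))) - 1#) * Q ⁻¹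
                               ≈⟨ *-congʳ (solve 1 (λ u →
                                    (u :* (u :* (u :* :- # 1 :+ (# 1 :+ u) :* # 2)
                                       :+ (# 1 :+ u) :* (u :- # 2))) :- # 1
                                    := (# 1 :+ u) :* ((# 2 :* u :* u :- u) :- # 1))
                                    refl U) ⟩
      (Q * Y) * Q ⁻¹           ≈⟨ solve 3 (λ q y i → (q :* y) :* i := y :* (q :* i)) refl Q Y (Q ⁻¹) ⟩
      Y * (Q * Q ⁻¹)           ≈⟨ *-congˡ (⁻¹-inverseʳ Q q≉0) ⟩
      Y * 1#                   ≈⟨ *-identityʳ Y ⟩
      Y                        ∎

-- Only q = #F and char K = 0 (so that q is invertible in K) are used: after
-- rewriting #V = 1 + q and q = 1 + u both sides are expressions in u = #F^×.
theorem3p1 : (p q n l : ℕ) → Prime p → n ≥ 1 → q ≡ p ^ n → Prime l → l ≢ p →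
    (F : FiniteField) → FiniteField.card F ≡ q →
    (K : Field) → CharZero K → AlgClosed K →
    (θ : FiniteField.Carrier F → Field.Carrier K) → NontrivialAdditiveCharacter F K θ →
    let open Field K in
    ι (TwistedCubic.#V F)
      ≈ (((- (ι 2 * ι q * ι q)) + ι 6 * ι q) - 1#)
        + ((ι (q ∸ 1) * ExpSum.L F K θ) - 1#) * (ι q ⁻¹)
theorem3p1 _ _ _ _ _ _ _ _ _ F ≡.refl K charZero _ θ χ
  rewrite TwistedCubicPoints.#V≡1+q F | NatCounting.card≡1+#units F =
  ClosedForm.closed-form K (charZero (length (FiniteField.units F))) (ExponentialSum.L-value F K θ χ)
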